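{- If a simple connected graph $G$ contains a vertex adjacent to at least three pendant vertices, then $md(G)=\infty$.
   Context: A pendant vertex is a vertex of degree $1$. For $W\subseteq V(G)$, $r_m(v|W)$ is the multiset $\{d(v,w): w\in W\}$ of graph distances; $W$ is an m-resolving set if $r_m(u|W)\neq r_m(v|W)$ for all distinct $u,v\in V(G)$. If $G$ has an m-resolving set, $md(G)$ is the minimum cardinality of one; otherwise $md(G)=\infty$. -}

module Defs where

open import Data.Nat using (ℕ; zero; suc)
open import Data.Bool using (Bool; true; false; _∧_; _∨_; if_then_else_)
open import Data.Fin using (Fin; _≟_)
open import Data.Fin.Subset using (Subset; _∈_)
open import Data.List using (List; []; _∷_; map; filter; length)
open import Data.Bool.ListAction using (any)
open import Data.List.Base using (allFin) renaming (map to lmap)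
open import Data.List.Relation.Binary.Permutation.Propositional using (_↭_)
open import Data.Product using (Σ; ∃; _×_; _,_)
open import Relation.Nullary using (¬_; does)
open import Relation.Binary.PropositionalEquality using (_≡_; _≢_)
open import Data.Vec using (toList; tabulate; lookup)

record Graph (n : ℕ) : Set where
  field
    Adj   : Fin n → Fin n → Bool
    sym   : ∀ u v → Adj u v ≡ Adj v u
    irrefl : ∀ v → Adj v v ≡ false
open Graph public

module _ {n : ℕ} (G : Graph n) where

  data Walk : Fin n → Fin n → ℕ → Set where
    here : ∀ {v} → Walk v v zero
    step : ∀ {u w v k} → Adj G u w ≡ true → Walk w v k → Walk u v (suc k)

  Connected : Set
  Connected = ∀ u v → ∃ λ k → Walk u v k

  reachWithin : ℕ → Fin n → Fin n → Bool
  reachWithin zero u v = does (u ≟ v)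
  reachWithin (suc k) u v =
    reachWithin k u v ∨ any (λ w → Adj G u w ∧ reachWithin k w v) (allFin n)

  -- graph distance: least k ≤ n with a walk of length ≤ k
  -- (value n returned if v is unreachable; never happens for connected G,
  --  since a shortest walk has length < n)
  distFrom : ℕ → ℕ → Fin n → Fin n → ℕ
  distFrom k zero u v = k
  distFrom k (suc fuel) u v =
    if reachWithin k u v then k else distFrom (suc k) fuel u v

  dist : Fin n → Fin n → ℕ
  dist u v = distFrom 0 n u v

  degree : Fin n → ℕ
  degree v = length (filter (λ w → Adj G v w Data.Bool.≟ true) (allFin n))
    where import Data.Bool

  Pendant : Fin n → Set
  Pendant v = degree v ≡ 1

  elems : Subset n → List (Fin n)
  elems W = filter (λ w → w ∈? W) (allFin n)
    where open import Data.Fin.Subset.Properties using (_∈?_)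

  -- r_m(v | W): the multiset of distances, as a list compared up to permutation
  rm : Fin n → Subset n → List ℕ
  rm v W = map (dist v) (elems W)

  MResolving : Subset n → Set
  MResolving W = ∀ u v → u ≢ v → ¬ (rm u W ↭ rm v W)

  -- md(G) = ∞  iff  G has no m-resolving set
  mdInfinite : Set
  mdInfinite = ∀ W → ¬ MResolving W

module Submission where

-- Two pendant vertices a, b hanging from the same vertex v are
-- "twins": every vertex x ∉ {a, b} is at the same distance from a and from b,
-- d(a,a) = d(b,b) = 0 and d(a,b) = d(b,a) = 2.  Hence the distance profiles
-- d(a,-) and d(b,-) differ only by the transposition of a and b, so for any W
-- that contains both twins or neither of them, the multisets r_m(a|W) and
-- r_m(b|W) coincide and W is not m-resolving.  Given three pendant neighbours
-- of v, by pigeonhole two of them lie on the same side of W.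

open import Defs hiding (sym)
open import Data.Nat using (ℕ; zero; suc; _≤_; s≤s; z≤n)
open import Data.Fin using (Fin; _≟_)
open import Data.Fin.Subset using (Subset) renaming (_∈_ to _∈ₛ_; _∉_ to _∉ₛ_)
open import Data.Fin.Subset.Properties using (_∈?_)
open import Data.Bool using (Bool; true; false; _∧_; _∨_; if_then_else_)
open import Data.Bool.Properties using (∨-zeroʳ)
open import Data.Bool.ListAction using (any)
open import Data.Product using (_×_; _,_; proj₂)
open import Data.Sum using (_⊎_; inj₁; inj₂)
open import Data.Empty using (⊥-elim)
open import Relation.Nullary using (¬_; yes; no)
open import Relation.Nullary.Decidable using (dec-true; dec-false)
open import Relation.Unary using (Decidable)
open import Relation.Binary.PropositionalEquality
  using (_≡_; _≢_; refl; sym; ≢-sym; trans; cong; cong₂; subst; module ≡-Reasoning)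
open import Data.List using (List; []; _∷_; map; filter; length; allFin)
open import Data.List.Membership.Propositional using (_∈_)
open import Data.List.Membership.Propositional.Properties
  using (∈-filter⁺; ∈-filter⁻; ∈-allFin)
open import Data.List.Relation.Unary.Any using (here; there)
open import Data.List.Relation.Unary.All as All using (All; []; _∷_)
open import Data.List.Relation.Unary.AllPairs using (_∷_)
open import Data.List.Relation.Unary.Unique.Propositional using (Unique)
open import Data.List.Relation.Unary.Unique.Propositional.Properties
  using (allFin⁺; filter⁺)
open import Data.List.Relation.Binary.Permutation.Propositional
  using (_↭_; ↭-refl; ↭-prep; ↭-swap; ↭-reflexive; module PermutationReasoning)

record SwappedAt {A B : Set} (f g : A → B) (a b : A) : Set where
  field
    outside : ∀ x → x ≢ a → x ≢ b → f x ≡ g x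
    at-a    : f a ≡ g b
    at-b    : f b ≡ g a

swappedAt-sym : ∀ {A B : Set} {f g : A → B} {a b : A} →
  SwappedAt f g a b → SwappedAt f g b a
swappedAt-sym s = record
  { outside = λ x x≢b x≢a → outside x x≢a x≢b ; at-a = at-b ; at-b = at-a }
  where open SwappedAt s

map-swapped-avoiding : ∀ {A B : Set} {f g : A → B} {a b : A} → SwappedAt f g a b →
  (xs : List A) → All (_≢ a) xs → All (_≢ b) xs → map f xs ≡ map g xs
map-swapped-avoiding s []       []           []           = refl
map-swapped-avoiding s (x ∷ xs) (x≢a ∷ ≢as) (x≢b ∷ ≢bs) =
  cong₂ _∷_ (SwappedAt.outside s x x≢a x≢b) (map-swapped-avoiding s xs ≢as ≢bs)

head-fresh : ∀ {A : Set} {y : A} {ys : List A} → Unique (y ∷ ys) → All (_≢ y) ys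
head-fresh (y≢ys ∷ _) = All.map ≢-sym y≢ys

cons-swapped : ∀ {A B : Set} {f g : A → B} {a b : A} → SwappedAt f g a b →
  (xs : List A) → Unique xs → b ∈ xs → All (_≢ a) xs →
  (f a ∷ map f xs) ↭ (g a ∷ map g xs)
cons-swapped {f = f} {g} {a} s (y ∷ ys) uniq (here refl) (_ ∷ ≢as) = begin
  f a ∷ f y ∷ map f ys   ≡⟨ cong₂ (λ u w → u ∷ w ∷ map f ys) at-a at-b ⟩
  g y ∷ g a ∷ map f ys   ≡⟨ cong (λ zs → g y ∷ g a ∷ zs) (map-swapped-avoiding s ys ≢as (head-fresh uniq)) ⟩
  g y ∷ g a ∷ map g ys   ↭⟨ ↭-swap _ _ ↭-refl ⟩
  g a ∷ g y ∷ map g ys   ∎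
  where open PermutationReasoning
        open SwappedAt s
cons-swapped {f = f} {g} {a} {b} s (y ∷ ys) uniq@(_ ∷ uniq-ys) (there b∈ys) (y≢a ∷ ≢as) = begin
  f a ∷ f y ∷ map f ys   ↭⟨ ↭-swap _ _ ↭-refl ⟩
  f y ∷ f a ∷ map f ys   ↭⟨ ↭-prep (f y) (cons-swapped s ys uniq-ys b∈ys ≢as) ⟩
  f y ∷ g a ∷ map g ys   ≡⟨ cong (λ u → u ∷ g a ∷ map g ys) (SwappedAt.outside s y y≢a y≢b) ⟩
  g y ∷ g a ∷ map g ys   ↭⟨ ↭-swap _ _ ↭-refl ⟩
  g a ∷ g y ∷ map g ys   ∎
  where open PermutationReasoning
        y≢b : y ≢ b
        y≢b = ≢-sym (All.lookup (head-fresh uniq) b∈ys)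

map-swapped-containing : ∀ {A B : Set} {f g : A → B} {a b : A} → SwappedAt f g a b →
  (xs : List A) → Unique xs → a ∈ xs → b ∈ xs → map f xs ↭ map g xs
map-swapped-containing s (x ∷ xs) uniq (here refl) (here refl) =
  ↭-reflexive (cong₂ _∷_ (SwappedAt.at-a s)
    (map-swapped-avoiding s xs (head-fresh uniq) (head-fresh uniq)))
map-swapped-containing s (x ∷ xs) uniq@(_ ∷ uniq-xs) (here refl) (there b∈xs) =
  cons-swapped s xs uniq-xs b∈xs (head-fresh uniq)
map-swapped-containing s (x ∷ xs) uniq@(_ ∷ uniq-xs) (there a∈xs) (here refl) =
  cons-swapped (swappedAt-sym s) xs uniq-xs a∈xs (head-fresh uniq)
map-swapped-containing {f = f} {g} s (x ∷ xs) uniq@(_ ∷ uniq-xs) (there a∈xs) (there b∈xs) =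
  subst (λ u → (f x ∷ map f xs) ↭ (u ∷ map g xs)) x-fixed
    (↭-prep (f x) (map-swapped-containing s xs uniq-xs a∈xs b∈xs))
  where
    x-fixed : f x ≡ g x
    x-fixed = SwappedAt.outside s x (≢-sym (All.lookup (head-fresh uniq) a∈xs))
                                    (≢-sym (All.lookup (head-fresh uniq) b∈xs))

distinct-members⇒length≥2 : ∀ {A : Set} {x y : A} {xs : List A} →
  x ∈ xs → y ∈ xs → x ≢ y → 2 ≤ length xs
distinct-members⇒length≥2 {xs = _ ∷ _ ∷ _} _ _ _ = s≤s (s≤s z≤n)
distinct-members⇒length≥2 {xs = _ ∷ []} (here refl) (here refl) x≢y = ⊥-elim (x≢y refl)

any-witness : ∀ {A : Set} (p : A → Bool) {w : A} (xs : List A) →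
  w ∈ xs → p w ≡ true → any p xs ≡ true
any-witness p (x ∷ xs) (here refl) pw rewrite pw = refl
any-witness p (x ∷ xs) (there w∈xs) pw
  rewrite any-witness p xs w∈xs pw = ∨-zeroʳ (p x)

guarded-any-unique : ∀ {A : Set} (p f : A → Bool) {v : A} →
  (∀ w → p w ≡ true → w ≡ v) → p v ≡ true →
  (xs : List A) → v ∈ xs → any (λ w → p w ∧ f w) xs ≡ f v
guarded-any-unique p f {v} only-v pv xs v∈xs with f v in fv
... | true  = any-witness (λ w → p w ∧ f w) xs v∈xs (trans (cong (_∧ f v) pv) fv)
... | false = all-false xs
  where
    all-false : (ys : List _) → any (λ w → p w ∧ f w) ys ≡ false
    all-false []       = refl
    all-false (y ∷ ys) with p y in py
    ... | false = all-false ys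
    ... | true rewrite only-v y py | fv = all-false ys

atLeastTwo : ℕ → Bool
atLeastTwo (suc (suc _)) = true
atLeastTwo _             = false

SameSide : ∀ {n} → Subset n → Fin n → Fin n → Set
SameSide W x y = (x ∈ₛ W × y ∈ₛ W) ⊎ (x ∉ₛ W × y ∉ₛ W)

pigeonhole : ∀ {n} (W : Subset n) (a b c : Fin n) →
  SameSide W a b ⊎ SameSide W a c ⊎ SameSide W b c
pigeonhole W a b c with a ∈? W | b ∈? W | c ∈? W
... | yes a∈ | yes b∈ | _      = inj₁ (inj₁ (a∈ , b∈))
... | no  a∉ | no  b∉ | _      = inj₁ (inj₂ (a∉ , b∉))
... | yes a∈ | no  _  | yes c∈ = inj₂ (inj₁ (inj₁ (a∈ , c∈)))
... | no  a∉ | yes _  | no  c∉ = inj₂ (inj₁ (inj₂ (a∉ , c∉)))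
... | yes _  | no  b∉ | no  c∉ = inj₂ (inj₂ (inj₂ (b∉ , c∉)))
... | no  _  | yes b∈ | yes c∈ = inj₂ (inj₂ (inj₁ (b∈ , c∈)))

module _ {n : ℕ} (G : Graph n) where

  elems-unique : (W : Subset n) → Unique (elems G W)
  elems-unique W = filter⁺ (_∈? W) (allFin⁺ n)

  elems-complete : (W : Subset n) {x : Fin n} → x ∈ₛ W → x ∈ elems G W
  elems-complete W {x} x∈W = ∈-filter⁺ (_∈? W) (∈-allFin x) x∈W

  elems-avoid : (W : Subset n) {x : Fin n} → x ∉ₛ W → All (_≢ x) (elems G W)
  elems-avoid W x∉W = All.tabulate λ y∈elems y≡x →
    x∉W (subst (_∈ₛ W) y≡x (proj₂ (∈-filter⁻ (_∈? W) {xs = allFin n} y∈elems)))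

  pendant-unique-neighbour : ∀ {a v w} → Pendant G a →
    Adj G a v ≡ true → Adj G a w ≡ true → w ≡ v
  pendant-unique-neighbour {a} {v} {w} pa av aw with w ≟ v
  ... | yes w≡v = w≡v
  ... | no  w≢v = ⊥-elim (2≰1 (subst (2 ≤_) pa
          (distinct-members⇒length≥2 (∈-filter⁺ adj? (∈-allFin w) aw)
                                     (∈-filter⁺ adj? (∈-allFin v) av) w≢v)))
    where
      adj? : Decidable (λ z → Adj G a z ≡ true)
      adj? z = Adj G a z Data.Bool.≟ true
      2≰1 : ¬ (2 ≤ 1)
      2≰1 (s≤s ())

  reach-refl : ∀ x k → reachWithin G k x x ≡ true
  reach-refl x zero = dec-true (x ≟ x) refl
  reach-refl x (suc k) rewrite reach-refl x k = refl

  reach-pendant-step : ∀ {a v} → Pendant G a → Adj G a v ≡ true → ∀ k x →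
    reachWithin G (suc k) a x ≡ (reachWithin G k a x ∨ reachWithin G k v x)
  reach-pendant-step {a} {v} pa av k x =
    cong (reachWithin G k a x ∨_)
      (guarded-any-unique (Adj G a) (λ w → reachWithin G k w x)
        (λ w → pendant-unique-neighbour pa av) av (allFin n) (∈-allFin v))

  -- Vertices whose bounded reachability agrees at every bound have equal
  -- distances (the search in distFrom only consults reachWithin).
  dist-cong : ∀ {u x u' x'} → (∀ k → reachWithin G k u x ≡ reachWithin G k u' x') →
    ∀ k fuel → distFrom G k fuel u x ≡ distFrom G k fuel u' x'
  dist-cong same k zero = refl
  dist-cong {u' = u'} {x'} same k (suc fuel) rewrite same k =
    cong (if reachWithin G k u' x' then k else_) (dist-cong same (suc k) fuel)

  dist-self : ∀ x fuel → distFrom G 0 fuel x x ≡ 0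
  dist-self x zero = refl
  dist-self x (suc fuel) rewrite dec-true (x ≟ x) refl = refl

  reach-pendant-to-sibling : ∀ {a v b} → Pendant G a → Adj G a v ≡ true →
    Adj G v b ≡ true → a ≢ b → ∀ k → reachWithin G k a b ≡ atLeastTwo k
  reach-pendant-to-sibling {a} {b = b} pa av vb a≢b zero = dec-false (a ≟ b) a≢b
  reach-pendant-to-sibling {a} {v} {b} pa av vb a≢b (suc zero) =
    trans (reach-pendant-step pa av 0 b) (cong₂ _∨_ (dec-false (a ≟ b) a≢b) (dec-false (v ≟ b) v≢b))
    where
      v≢b : v ≢ b
      v≢b refl with trans (sym vb) (irrefl G v)
      ... | ()
  reach-pendant-to-sibling {a} {v} {b} pa av vb a≢b (suc (suc k)) = begin
    reachWithin G (suc (suc k)) a b                   ≡⟨ reach-pendant-step pa av (suc k) b ⟩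
    reachWithin G (suc k) a b ∨ reachWithin G (suc k) v b
                                                      ≡⟨ cong (reachWithin G (suc k) a b ∨_) v-reaches-b ⟩
    reachWithin G (suc k) a b ∨ true                  ≡⟨ ∨-zeroʳ _ ⟩
    true                                              ∎
    where
      open ≡-Reasoning
      v-reaches-b : reachWithin G (suc k) v b ≡ true
      v-reaches-b = trans
        (cong (reachWithin G k v b ∨_)
          (any-witness (λ w → Adj G v w ∧ reachWithin G k w b) (allFin n) (∈-allFin b)
            (trans (cong (_∧ reachWithin G k b b) vb) (reach-refl b k))))
        (∨-zeroʳ _)

  module PendantTwins {a b v : Fin n} (pa : Pendant G a) (pb : Pendant G b)
      (va : Adj G v a ≡ true) (vb : Adj G v b ≡ true) (a≢b : a ≢ b) where

    av : Adj G a v ≡ true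
    av = trans (Graph.sym G a v) va

    bv : Adj G b v ≡ true
    bv = trans (Graph.sym G b v) vb

    reach-twins : ∀ x → x ≢ a → x ≢ b → ∀ k →
      reachWithin G k a x ≡ reachWithin G k b x
    reach-twins x x≢a x≢b zero =
      trans (dec-false (a ≟ x) (≢-sym x≢a)) (sym (dec-false (b ≟ x) (≢-sym x≢b)))
    reach-twins x x≢a x≢b (suc k) = begin
      reachWithin G (suc k) a x                   ≡⟨ reach-pendant-step pa av k x ⟩
      reachWithin G k a x ∨ reachWithin G k v x   ≡⟨ cong (_∨ reachWithin G k v x) (reach-twins x x≢a x≢b k) ⟩
      reachWithin G k b x ∨ reachWithin G k v x   ≡⟨ sym (reach-pendant-step pb bv k x) ⟩
      reachWithin G (suc k) b x                   ∎
      where open ≡-Reasoning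

    twin-distances : SwappedAt (dist G a) (dist G b) a b
    twin-distances = record
      { outside = λ x x≢a x≢b → dist-cong (reach-twins x x≢a x≢b) 0 n
      ; at-a    = trans (dist-self a n) (sym (dist-self b n))
      ; at-b    = dist-cong (λ k → trans (reach-pendant-to-sibling pa av vb a≢b k)
                                         (sym (reach-pendant-to-sibling pb bv va (≢-sym a≢b) k))) 0 n
      }

    twins-not-separated : (W : Subset n) → SameSide W a b → rm G a W ↭ rm G b W
    twins-not-separated W (inj₁ (a∈W , b∈W)) =
      map-swapped-containing twin-distances (elems G W) (elems-unique W)
        (elems-complete W a∈W) (elems-complete W b∈W)
    twins-not-separated W (inj₂ (a∉W , b∉W)) =
      ↭-reflexive (map-swapped-avoiding twin-distances (elems G W)
        (elems-avoid W a∉W) (elems-avoid W b∉W))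

corollary3p5 : ∀ {n : ℕ} (G : Graph n) → Connected G →
    (v a b c : Fin n) →
    Adj G v a ≡ true → Adj G v b ≡ true → Adj G v c ≡ true →
    Pendant G a → Pendant G b → Pendant G c →
    a ≢ b → a ≢ c → b ≢ c →
    mdInfinite G
corollary3p5 G _ v a b c va vb vc pa pb pc a≢b a≢c b≢c W resolving
  with pigeonhole W a b c
... | inj₁ ab        = resolving a b a≢b (PendantTwins.twins-not-separated G pa pb va vb a≢b W ab)
... | inj₂ (inj₁ ac) = resolving a c a≢c (PendantTwins.twins-not-separated G pa pc va vc a≢c W ac)
... | inj₂ (inj₂ bc) = resolving b c b≢c (PendantTwins.twins-not-separated G pb pc vb vc b≢c W bc)
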